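{- Let $G$ be a connected graph, let $\sigma$ be a BFS ordering of $G$ with $\mathcal{F}$-tree $T_\sigma$, and let $S$ be the set of the first $k$ internal vertices of $T_\sigma$ (with respect to the order $\sigma$). Let $\rho'$ be the ordering of $S$ induced by $\sigma$, let $\rho$ be any ordering of $V(G)$ starting with $\rho'$, let $\tau$ be the $\mathrm{BFS}^+_\rho$ ordering of $G$, and let $T_\tau$ be its $\mathcal{F}$-tree. Then every $v\in S$ has the same set of children in $T_\sigma$ as in $T_\tau$.
   Context: All graphs are finite, simple, undirected, connected and non-empty. A BFS ordering is one producible by standard queue-based Breadth-First Search. For a linear ordering $\rho$ of $V(G)$, the $\mathrm{BFS}^+_\rho$ ordering is the BFS ordering obtained by using $\rho$ as tie-breaker: whenever BFS has several valid choices for the next vertex (including the start vertex), it takes the one leftmost in $\rho$. The $\mathcal{F}$-tree of $\sigma=(v_1,\dots,v_n)$ is the spanning tree rooted at $v_1$ in which, for $i>1$, the parent of $v_i$ is its leftmost neighbor in $\sigma$; a leaf is a vertex with no children, the root is never a leaf, and all non-leaves (including the root) are internal. -}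

module Defs where

open import Data.Nat using (ℕ; zero; suc; _≤_)
open import Data.Fin using (Fin; _≟_)
open import Data.Bool using (Bool; true; false; if_then_else_; _∧_; _∨_; not)
open import Data.Maybe using (Maybe; just; nothing)
import Data.Maybe as Maybe
open import Data.List using (List; []; _∷_; _++_; filter)
open import Data.Bool.ListAction using (any)
open import Data.List.Membership.Propositional using (_∈_; _∉_)
open import Data.List.Relation.Unary.Unique.Propositional using (Unique)
open import Data.Product using (Σ; _×_; ∃)
open import Data.Sum using (_⊎_)
open import Relation.Nullary.Decidable using (⌊_⌋)
open import Relation.Binary.PropositionalEquality using (_≡_)

record Graph (n : ℕ) : Set where
  field
    adj    : Fin n → Fin n → Bool
    sym    : ∀ u v → adj u v ≡ adj v u
    irrefl : ∀ v → adj v v ≡ false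
open Graph public

data Reach {n : ℕ} (G : Graph n) : Fin n → Fin n → Set where
  here : ∀ {u} → Reach G u u
  step : ∀ {u w v} → adj G u w ≡ true → Reach G w v → Reach G u v

Connected : ∀ {n} → Graph n → Set
Connected G = ∀ u v → Reach G u v

IsOrdering : ∀ {n} → List (Fin n) → Set
IsOrdering σ = Unique σ × (∀ v → v ∈ σ)

-- a occurs (weakly) before b in ρ
Before : ∀ {n} → List (Fin n) → Fin n → Fin n → Set
Before ρ a b = Σ _ λ xs → Σ _ λ ys → ρ ≡ xs ++ a ∷ ys × b ∈ (a ∷ ys)

firstIdx : ∀ {n} → Graph n → List (Fin n) → Fin n → Maybe ℕ
firstIdx G []       w = nothing
firstIdx G (x ∷ xs) w = if adj G x w then just 0 else Maybe.map suc (firstIdx G xs w)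

-- Valid choices of queue-based BFS for the next vertex after having
-- visited the prefix p (in this order): any vertex when p is empty;
-- otherwise an unvisited vertex adjacent to the earliest-visited vertex
-- (the queue front) that still has unvisited neighbours, i.e. an
-- unvisited vertex whose leftmost visited neighbour is as early as possible.
ValidNext : ∀ {n} → Graph n → List (Fin n) → Fin n → Set
ValidNext G p w =
  w ∉ p ×
  (p ≡ [] ⊎
   Σ ℕ λ i → firstIdx G p w ≡ just i ×
     (∀ x j → x ∉ p → firstIdx G p x ≡ just j → i ≤ j))

IsBFS : ∀ {n} → Graph n → List (Fin n) → Set
IsBFS G σ = IsOrdering σ ×
  (∀ p w q → σ ≡ p ++ w ∷ q → ValidNext G p w)

-- τ is the BFS⁺_ρ ordering: at each step (including the start) it takes the
-- leftmost-in-ρ valid choice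
IsBFSPlus : ∀ {n} → Graph n → List (Fin n) → List (Fin n) → Set
IsBFSPlus G ρ τ = IsBFS G τ ×
  (∀ p w q → τ ≡ p ++ w ∷ q → ∀ x → ValidNext G p x → Before ρ w x)

isRoot : ∀ {n} → List (Fin n) → Fin n → Bool
isRoot []      v = false
isRoot (x ∷ _) v = ⌊ x ≟ v ⌋

firstNbr : ∀ {n} → Graph n → List (Fin n) → Fin n → Maybe (Fin n)
firstNbr G []       c = nothing
firstNbr G (x ∷ xs) c = if adj G x c then just x else firstNbr G xs c

isParent : ∀ {n} → Maybe (Fin n) → Fin n → Bool
isParent nothing  p = false
isParent (just x) p = ⌊ x ≟ p ⌋

-- c is a child of p in the F-tree of σ
isChild : ∀ {n} → Graph n → List (Fin n) → Fin n → Fin n → Bool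
isChild G σ p c = not (isRoot σ c) ∧ isParent (firstNbr G σ c) p

ChildOf : ∀ {n} → Graph n → List (Fin n) → Fin n → Fin n → Set
ChildOf G σ p c = isChild G σ p c ≡ true

isInternal : ∀ {n} → Graph n → List (Fin n) → Fin n → Bool
isInternal G σ v = isRoot σ v ∨ any (isChild G σ v) σ

internals : ∀ {n} → Graph n → List (Fin n) → List (Fin n)
internals G σ = filter (λ v → isInternal G σ v Data.Bool.≟ true) σ

-- Let ι, κ be positions in σ, τ and S the first k internal vertices of T_σ. Both orderings
-- start at the root of T_σ, which is the first vertex of ρ. The key invariant of s ∈ S is
-- that every vertex before s in τ is also before s in σ: it makes the σ-parent of any vertex
-- still its leftmost neighbour in τ. The σ-parent p of s ∈ S is
-- internal and earlier, so p ∈ S and p is also the τ-parent of s. A vertex y before s in τ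
-- has a τ-parent q with κ q ≤ κ p, since BFS parents are monotone. If κ q < κ p then
-- ι q < ι p, and s before y in σ would give ι p ≤ ι (σ-parent of y) ≤ ι q. If q = p then y, s
-- are τ-siblings, so BFS⁺ took y first because y precedes s in ρ; as ρ starts with S in
-- σ-order, y precedes s in σ. Conversely, the σ-parent u of a τ-child of v ∈ S has
-- ι u ≤ ι v, and ι u < ι v would put u in S and make u the τ-parent, so u = v.
module Submission where

open import Defs hiding (sym)
open import Data.Bool using (true; false)
open import Data.Bool.Properties using (T-≡; T-∨)
open import Data.Empty using (⊥-elim)
open import Data.Fin using (Fin; zero; _≟_)
open import Data.List using (List; []; _∷_; _++_; take; drop; length; filter)
open import Data.List.Membership.Propositional using (_∈_; _∉_)
open import Data.List.Membership.Propositional.Properties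
  using (∈-∃++; ∈-++⁺ˡ; ∈-++⁺ʳ; ∈-filter⁺; ∈-filter⁻)
open import Data.List.Properties using (take++drop≡id; filter-accept)
open import Data.List.Relation.Unary.All as All using ()
open import Data.List.Relation.Unary.AllPairs using (_∷_)
open import Data.List.Relation.Unary.Any as Any using (here; there; tail)
open import Data.List.Relation.Unary.Any.Properties using (any⁺)
open import Data.List.Relation.Unary.Unique.Propositional using (Unique)
open import Data.Maybe using (just; nothing)
import Data.Maybe as Maybe
open import Data.Maybe.Properties using (just-injective)
open import Data.Nat using (ℕ; zero; suc; _+_; _≤_; _<_; z≤n; s≤s)
open import Data.Nat.Induction using (<-wellFounded)
open import Data.Nat.Properties hiding (_≟_)
open import Data.Product using (Σ; ∃; ∃₂; _×_; _,_; proj₁; proj₂)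
open import Data.Sum using (_⊎_; inj₁; inj₂)
open import Function.Base using (_∘_)
open import Function.Bundles using (_⇔_; mk⇔; Equivalence)
open import Induction.WellFounded as WF using ()
open import Level using (0ℓ)
import Relation.Binary.Construct.On as On
open import Relation.Binary.Definitions using (DecidableEquality; tri<; tri≈; tri>)
open import Relation.Binary.PropositionalEquality
open import Relation.Nullary using (yes; no)
open import Relation.Unary using (Pred; Decidable)

module ListPosition {a} {A : Set a} (_≟_ : DecidableEquality A) where

  -- The position of the first occurrence; a non-member of xs gets length xs.
  position : List A → A → ℕ
  position []       y = 0
  position (x ∷ xs) y with x ≟ y
  ... | yes _ = 0
  ... | no  _ = suc (position xs y)

  position-head : ∀ {x xs} → position (x ∷ xs) x ≡ 0
  position-head {x} with x ≟ x
  ... | yes _   = refl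
  ... | no  x≢x = ⊥-elim (x≢x refl)

  position-there : ∀ {x y xs} → x ≢ y → position (x ∷ xs) y ≡ suc (position xs y)
  position-there {x} {y} x≢y with x ≟ y
  ... | yes x≡y = ⊥-elim (x≢y x≡y)
  ... | no  _   = refl

  position≡0⇒head : ∀ {x y xs} → position (x ∷ xs) y ≡ 0 → x ≡ y
  position≡0⇒head {x} {y} eq with x ≟ y
  position≡0⇒head () | no _
  ... | yes x≡y = x≡y

  head⊎0<position : ∀ {x xs} y → x ≡ y ⊎ 0 < position (x ∷ xs) y
  head⊎0<position {x} y with x ≟ y
  ... | yes x≡y = inj₁ x≡y
  ... | no  _   = inj₂ (s≤s z≤n)

  0<position-∷ : ∀ {x y xs ys} → 0 < position (x ∷ xs) y → 0 < position (x ∷ ys) y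
  0<position-∷ {x} {y} 0<pos with x ≟ y
  ... | yes _ = ⊥-elim (n≮0 0<pos)
  ... | no  _ = s≤s z≤n

  position<length : ∀ {xs y} → y ∈ xs → position xs y < length xs
  position<length {x ∷ xs} {y} y∈ with x ≟ y
  ... | yes _   = s≤s z≤n
  ... | no  x≢y = s≤s (position<length (tail (≢-sym x≢y) y∈))

  position-injective : ∀ {xs a b} → a ∈ xs → b ∈ xs → position xs a ≡ position xs b → a ≡ b
  position-injective {x ∷ xs} {a} {b} a∈ b∈ eq with x ≟ a | x ≟ b
  ... | yes refl | yes refl = refl
  position-injective _ _ () | yes _ | no _
  position-injective _ _ () | no _  | yes _
  ... | no x≢a | no x≢b =
    position-injective (tail (≢-sym x≢a) a∈) (tail (≢-sym x≢b) b∈) (suc-injective eq)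

  position-++ˡ : ∀ {p r y} → y ∈ p → position (p ++ r) y ≡ position p y
  position-++ˡ {x ∷ p} {r} {y} y∈ with x ≟ y
  ... | yes _   = refl
  ... | no  x≢y = cong suc (position-++ˡ {p} {r} (tail (≢-sym x≢y) y∈))

  position-++ʳ : ∀ {p r y} → y ∉ p → position (p ++ r) y ≡ length p + position r y
  position-++ʳ {[]}    _  = refl
  position-++ʳ {x ∷ p} {r} {y} y∉ with x ≟ y
  ... | yes refl = ⊥-elim (y∉ (here refl))
  ... | no  _    = cong suc (position-++ʳ {p} {r} (y∉ ∘ there))

  position-split : ∀ {p q w} → w ∉ p → position (p ++ w ∷ q) w ≡ length p
  position-split {p} {q} {w} w∉p = begin
    position (p ++ w ∷ q) w       ≡⟨ position-++ʳ {p} w∉p ⟩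
    length p + position (w ∷ q) w ≡⟨ cong (length p +_) position-head ⟩
    length p + 0                  ≡⟨ +-identityʳ (length p) ⟩
    length p                      ∎
    where open ≡-Reasoning

  position-++<length⇒∈ : ∀ {p r y} → position (p ++ r) y < length p → y ∈ p
  position-++<length⇒∈ {x ∷ p} {r} {y} lt with x ≟ y
  ... | yes refl = here refl
  ... | no  _    = there (position-++<length⇒∈ {p} {r} (≤-pred lt))

  position-++<⇒∈ˡ : ∀ {p r y s} → s ∈ p → position (p ++ r) y < position (p ++ r) s → y ∈ p
  position-++<⇒∈ˡ {p} {r} s∈p lt = position-++<length⇒∈ {p} {r}
    (<-trans (<-≤-trans lt (≤-reflexive (position-++ˡ {p} {r} s∈p))) (position<length s∈p))

  module _ {k : ℕ} {xs : List A} where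

    private
      take++drop : take k xs ++ drop k xs ≡ xs
      take++drop = take++drop≡id k xs

    ∈-take⇒∈ : ∀ {y} → y ∈ take k xs → y ∈ xs
    ∈-take⇒∈ y∈ = subst (_ ∈_) take++drop (∈-++⁺ˡ y∈)

    position-take : ∀ {y} → y ∈ take k xs → position (take k xs) y ≡ position xs y
    position-take {y} y∈ =
      trans (sym (position-++ˡ {r = drop k xs} y∈)) (cong (λ l → position l y) take++drop)

    position<⇒∈-take : ∀ {y s} → s ∈ take k xs → position xs y < position xs s → y ∈ take k xs
    position<⇒∈-take {y} {s} s∈ lt = position-++<⇒∈ˡ {r = drop k xs} s∈
      (subst (λ l → position l y < position l s) (sym take++drop) lt)

  module _ {p} {P : Pred A p} (P? : Decidable P) where

    position-filter-mono : ∀ {xs y s} → y ∈ filter P? xs → s ∈ filter P? xs →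
      position xs y < position xs s → position (filter P? xs) y < position (filter P? xs) s
    position-filter-mono {x ∷ xs} {y} {s} y∈ s∈ lt with x ≟ y | x ≟ s
    ... | yes refl | yes refl = ⊥-elim (<-irrefl refl lt)
    ... | no  _    | yes refl = ⊥-elim (n≮0 lt)
    ... | yes refl | no x≢s with P? x
    ...   | yes _  = subst₂ _<_ (sym (position-head {xs = filter P? xs}))
                       (sym (position-there {xs = filter P? xs} x≢s)) (s≤s z≤n)
    ...   | no ¬Px = ⊥-elim (¬Px (proj₂ (∈-filter⁻ P? {xs = xs} y∈)))
    position-filter-mono {x ∷ xs} {y} {s} y∈ s∈ lt | no x≢y | no x≢s with P? x
    ...   | yes _ = subst₂ _<_ (sym (position-there {xs = filter P? xs} x≢y))
                      (sym (position-there {xs = filter P? xs} x≢s))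
                      (s≤s (position-filter-mono {xs} (tail (≢-sym x≢y) y∈) (tail (≢-sym x≢s) s∈)
                                                     (≤-pred lt)))
    ...   | no  _ = position-filter-mono {xs} y∈ s∈ (≤-pred lt)

    position-filter-reflects-< : ∀ {xs y s} → y ∈ filter P? xs → s ∈ filter P? xs →
      position (filter P? xs) y < position (filter P? xs) s → position xs y < position xs s
    position-filter-reflects-< {xs} {y} {s} y∈ s∈ lt with <-cmp (position xs y) (position xs s)
    ... | tri< y<s _ _ = y<s
    ... | tri≈ _ eq _
      with position-injective (proj₁ (∈-filter⁻ P? {xs = xs} y∈))
                              (proj₁ (∈-filter⁻ P? {xs = xs} s∈)) eq
    ...   | refl = ⊥-elim (<-irrefl refl lt)
    position-filter-reflects-< {xs} y∈ s∈ lt | tri> _ _ s<y =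
      ⊥-elim (<-asym lt (position-filter-mono {xs} s∈ y∈ s<y))

open module FinPosition {m} = ListPosition (_≟_ {m})

unique-++⇒∉ : ∀ {a} {A : Set a} {xs ys : List A} {z} → Unique (xs ++ ys) → z ∈ ys → z ∉ xs
unique-++⇒∉ {xs = x ∷ xs} (x≢ ∷ _) z∈ys (here refl) = All.lookup x≢ (∈-++⁺ʳ xs z∈ys) refl
unique-++⇒∉ {xs = x ∷ xs} (_ ∷ xs!) z∈ys (there z∈xs) = unique-++⇒∉ xs! z∈ys z∈xs

Before⇒position≤ : ∀ {m} {ρ : List (Fin m)} {a b} → Unique ρ → Before ρ a b →
  position ρ a ≤ position ρ b
Before⇒position≤ {a = a} {b} ρ! (xs , ys , refl , b∈) = begin
  position (xs ++ a ∷ ys) a ≡⟨ position-split {p = xs} (unique-++⇒∉ ρ! (here refl)) ⟩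
  length xs                 ≤⟨ m≤m+n (length xs) _ ⟩
  length xs + _             ≡⟨ position-++ʳ {p = xs} (unique-++⇒∉ ρ! b∈) ⟨
  position (xs ++ a ∷ ys) b ∎
  where open ≤-Reasoning

module Neighbours {m} (G : Graph m) where

  private
    adj-false-true⇒≢ : ∀ {x u c} → adj G x c ≡ false → adj G u c ≡ true → x ≢ u
    adj-false-true⇒≢ x≁c u∼c refl with () ← trans (sym u∼c) x≁c

  firstNbr-++ : ∀ {p r c u} → firstNbr G p c ≡ just u → firstNbr G (p ++ r) c ≡ just u
  firstNbr-++ {x ∷ p} {r} {c} eq with adj G x c
  ... | true  = eq
  ... | false = firstNbr-++ {p} {r} eq

  firstNbr-adj : ∀ {xs c u} → firstNbr G xs c ≡ just u → adj G u c ≡ true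
  firstNbr-adj {x ∷ xs} {c} eq with adj G x c in x∼c
  firstNbr-adj refl | true  = x∼c
  ... | false = firstNbr-adj {xs} eq

  firstNbr-∈ : ∀ {xs c u} → firstNbr G xs c ≡ just u → u ∈ xs
  firstNbr-∈ {x ∷ xs} {c} eq with adj G x c
  firstNbr-∈ refl | true  = here refl
  ... | false = there (firstNbr-∈ {xs} eq)

  firstNbr-leftmost : ∀ {xs c u y} → firstNbr G xs c ≡ just u → y ∈ xs → adj G y c ≡ true →
    position xs u ≤ position xs y
  firstNbr-leftmost {x ∷ xs} {c} eq y∈ y∼c with adj G x c in x∼c
  firstNbr-leftmost {x ∷ xs} {y = y} refl y∈ y∼c | true =
    subst (_≤ position (x ∷ xs) y) (sym position-head) z≤n
  ... | false =
    let x≢u = adj-false-true⇒≢ x∼c (firstNbr-adj {xs} eq)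
        x≢y = adj-false-true⇒≢ x∼c y∼c
    in subst₂ _≤_ (sym (position-there x≢u)) (sym (position-there x≢y))
         (s≤s (firstNbr-leftmost {xs} eq (tail (≢-sym x≢y) y∈) y∼c))

  firstNbr≡nothing⇒¬adj : ∀ {xs c u} → firstNbr G xs c ≡ nothing → u ∈ xs → adj G u c ≢ true
  firstNbr≡nothing⇒¬adj {x ∷ xs} {c} eq u∈ u∼c with adj G x c in x∼c
  firstNbr≡nothing⇒¬adj () _ _ | true
  ... | false with u∈
  ...   | here refl = adj-false-true⇒≢ x∼c u∼c refl
  ...   | there u∈xs = firstNbr≡nothing⇒¬adj {xs} eq u∈xs u∼c

  leftmost⇒firstNbr : ∀ {xs c u} → u ∈ xs → adj G u c ≡ true →
    (∀ y → y ∈ xs → adj G y c ≡ true → position xs u ≤ position xs y) →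
    firstNbr G xs c ≡ just u
  leftmost⇒firstNbr {x ∷ xs} {c} {u} u∈ u∼c leftmost with adj G x c in x∼c
  ... | true  = cong just (position≡0⇒head (n≤0⇒n≡0
                  (subst (position (x ∷ xs) u ≤_) position-head (leftmost x (here refl) x∼c))))
  ... | false =
    let x≢u = adj-false-true⇒≢ x∼c u∼c
    in leftmost⇒firstNbr (tail (≢-sym x≢u) u∈) u∼c λ y y∈ y∼c →
         let x≢y = adj-false-true⇒≢ x∼c y∼c
         in ≤-pred (subst₂ _≤_ (position-there x≢u) (position-there x≢y)
                      (leftmost y (there y∈) y∼c))

  firstIdx≡position-firstNbr : ∀ {p w} → firstIdx G p w ≡ Maybe.map (position p) (firstNbr G p w)
  firstIdx≡position-firstNbr {[]} = refl
  firstIdx≡position-firstNbr {x ∷ p} {w} with adj G x w in x∼w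
  ... | true = cong just (sym position-head)
  ... | false with firstNbr G p w in eq | firstIdx≡position-firstNbr {p} {w}
  ...   | nothing | ih = cong (Maybe.map suc) ih
  ...   | just u  | ih = trans (cong (Maybe.map suc) ih)
          (cong just (sym (position-there (adj-false-true⇒≢ x∼w (firstNbr-adj {p} eq)))))

  firstNbr⇒firstIdx : ∀ {p w u} → firstNbr G p w ≡ just u → firstIdx G p w ≡ just (position p u)
  firstNbr⇒firstIdx {p} first =
    trans (firstIdx≡position-firstNbr {p}) (cong (Maybe.map (position p)) first)

  ChildOf⇔nonroot×firstNbr : ∀ {σ v c} →
    ChildOf G σ v c ⇔ (0 < position σ c × firstNbr G σ c ≡ just v)
  ChildOf⇔nonroot×firstNbr {σ} {v} {c} = mk⇔ (child⇒ {σ}) (⇒child {σ})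
    where
    child⇒ : ∀ {σ v c} → ChildOf G σ v c → 0 < position σ c × firstNbr G σ c ≡ just v
    child⇒ {[]} ()
    child⇒ {x ∷ σ} {v} {c} h with x ≟ c | firstNbr G (x ∷ σ) c
    child⇒ () | yes _ | _
    child⇒ () | no _  | nothing
    ... | no _ | just u with u ≟ v
    ...   | yes refl = s≤s z≤n , refl
    child⇒ () | no _ | just u | no _

    nonroot⇒isRoot≡false : ∀ {σ c} → 0 < position σ c → isRoot σ c ≡ false
    nonroot⇒isRoot≡false {[]}    _ = refl
    nonroot⇒isRoot≡false {x ∷ σ} {c} 0<pos with x ≟ c
    ... | yes _ = ⊥-elim (<-irrefl refl 0<pos)
    ... | no  _ = refl

    ⇒child : ∀ {σ v c} → 0 < position σ c × firstNbr G σ c ≡ just v → ChildOf G σ v c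
    ⇒child {σ} {v} (0<pos , eq) rewrite nonroot⇒isRoot≡false {σ} 0<pos | eq with v ≟ v
    ... | yes _   = refl
    ... | no  v≢v = ⊥-elim (v≢v refl)

module BFSOrdering {m} {G : Graph m} {σ : List (Fin m)} (bfs : IsBFS G σ) where

  open Neighbours G

  private
    ι : Fin m → ℕ
    ι = position σ

    σ-total : ∀ v → v ∈ σ
    σ-total = proj₂ (proj₁ bfs)

  -- The step at which BFS takes the non-root vertex a; parent is then the front of the queue.
  record Visit (a : Fin m) : Set where
    field
      visited unvisited : List (Fin m)
      split  : σ ≡ visited ++ a ∷ unvisited
      fresh  : a ∉ visited
      parent : Fin m
      parent-first   : firstNbr G visited a ≡ just parent
      parent-minimal : ∀ b j → b ∉ visited → firstIdx G visited b ≡ just j →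
                       position visited parent ≤ j

    ι≡position-visited : ∀ {y} → y ∈ visited → ι y ≡ position visited y
    ι≡position-visited {y} y∈ = trans (cong (λ l → position l y) split) (position-++ˡ y∈)

    ι≡length-visited : ι a ≡ length visited
    ι≡length-visited = trans (cong (λ l → position l a) split) (position-split fresh)

    visited⇒earlier : ∀ {y} → y ∈ visited → ι y < ι a
    visited⇒earlier y∈ = subst₂ _<_ (sym (ι≡position-visited y∈)) (sym ι≡length-visited)
                           (position<length y∈)

    unvisited⇒not-earlier : ∀ {y} → y ∉ visited → ι a ≤ ι y
    unvisited⇒not-earlier {y} y∉ = begin
      ι a                                          ≡⟨ ι≡length-visited ⟩
      length visited                               ≤⟨ m≤m+n _ _ ⟩
      length visited + position (a ∷ unvisited) y  ≡⟨ position-++ʳ y∉ ⟨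
      position (visited ++ a ∷ unvisited) y        ≡⟨ cong (λ l → position l y) split ⟨
      ι y                                          ∎
      where open ≤-Reasoning

    later⇒unvisited : ∀ {b} → ι a < ι b → b ∉ visited
    later⇒unvisited a<b b∈ = <-asym a<b (visited⇒earlier b∈)

    first-visited⇒first-σ : ∀ {c u} → firstNbr G visited c ≡ just u → firstNbr G σ c ≡ just u
    first-visited⇒first-σ {c} first =
      trans (cong (λ l → firstNbr G l c) split) (firstNbr-++ {p = visited} first)

    parent-σ : firstNbr G σ a ≡ just parent
    parent-σ = first-visited⇒first-σ parent-first

    parent∈visited : parent ∈ visited
    parent∈visited = firstNbr-∈ parent-first

  visit : ∀ a → 0 < ι a → Visit a
  visit a 0<ιa with p , q , eq ← ∈-∃++ (σ-total a) with proj₂ bfs p a q eq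
  ... | a∉p , inj₁ refl =
    ⊥-elim (<-irrefl (sym (trans (cong (λ l → position l a) eq) position-head)) 0<ιa)
  ... | a∉p , inj₂ (i , first≡i , minimal)
      with firstNbr G p a in first | firstIdx≡position-firstNbr {p = p} {w = a}
  ...   | nothing | idx≡ with () ← trans (sym first≡i) idx≡
  ...   | just u  | idx≡ = record
    { visited = p ; unvisited = q ; split = eq ; fresh = a∉p ; parent = u
    ; parent-first = first
    ; parent-minimal = λ b j b∉p idx≡j →
        subst (_≤ j) (just-injective (trans (sym first≡i) idx≡)) (minimal b j b∉p idx≡j)
    }

  parent-earlier : ∀ c → 0 < ι c → ∃ λ u → firstNbr G σ c ≡ just u × ι u < ι c
  parent-earlier c 0<ιc = parent , parent-σ , visited⇒earlier parent∈visited
    where open Visit (visit c 0<ιc)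

  parent-monotone : ∀ {a b u u'} → 0 < ι a → ι a < ι b →
    firstNbr G σ a ≡ just u → firstNbr G σ b ≡ just u' → ι u ≤ ι u'
  parent-monotone {a} {b} {u} {u'} 0<ιa a<b first-a first-b =
    subst (λ v → ι v ≤ ι u') (just-injective (trans (sym parent-σ) first-a)) parent≤u'
    where
    open Visit (visit a 0<ιa)
    parent≤u' : ι parent ≤ ι u'
    parent≤u' with firstNbr G visited b in first-b-visited
    ... | just u₁
      with refl ← just-injective (trans (sym (first-visited⇒first-σ first-b-visited)) first-b) =
      subst₂ _≤_ (sym (ι≡position-visited parent∈visited))
                 (sym (ι≡position-visited (firstNbr-∈ first-b-visited)))
        (parent-minimal b _ (later⇒unvisited a<b) (firstNbr⇒firstIdx {p = visited} first-b-visited))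
    ... | nothing = <⇒≤ (<-≤-trans (visited⇒earlier parent∈visited) (unvisited⇒not-earlier u'∉))
      where
      u'∉ : u' ∉ visited
      u'∉ u'∈ = firstNbr≡nothing⇒¬adj first-b-visited u'∈ (firstNbr-adj {σ} first-b)

  siblings-in-ρ-order : ∀ {ρ} → IsBFSPlus G ρ σ → ∀ {a b u} → 0 < ι a → ι a < ι b →
    firstNbr G σ a ≡ just u → firstNbr G σ b ≡ just u → Before ρ a b
  siblings-in-ρ-order (_ , ρ-least) {a} {b} {u} 0<ιa a<b first-a first-b =
    ρ-least visited a unvisited split b
      (later⇒unvisited a<b , inj₂ (_ , firstNbr⇒firstIdx {p = visited} first-b-visited , parent-minimal))
    where
    open Visit (visit a 0<ιa)
    first-b-parent : firstNbr G σ b ≡ just parent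
    first-b-parent = trans first-b (trans (sym first-a) parent-σ)
    first-b-visited : firstNbr G visited b ≡ just parent
    first-b-visited =
      leftmost⇒firstNbr parent∈visited (firstNbr-adj {σ} first-b-parent) λ y y∈ y∼b →
      subst₂ _≤_ (ι≡position-visited parent∈visited) (ι≡position-visited y∈)
        (firstNbr-leftmost first-b-parent (σ-total y) y∼b)

isInternal? : ∀ {m} (G : Graph m) σ → Decidable (λ v → isInternal G σ v ≡ true)
isInternal? G σ v = isInternal G σ v Data.Bool.≟ true

has-child⇒internal : ∀ {m} {G : Graph m} {σ u c} → c ∈ σ → ChildOf G σ u c →
  isInternal G σ u ≡ true
has-child⇒internal c∈σ child = Equivalence.to T-≡
  (Equivalence.from T-∨ (inj₂ (any⁺ _ (Any.map (λ { refl → Equivalence.from T-≡ child }) c∈σ))))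

module BFSPlusOnInternalPrefix
  {m} {G : Graph m} {x : Fin m} {σ' τ' ρ rest : List (Fin m)} (k : ℕ)
  (σ-bfs : IsBFS G (x ∷ σ')) (τ-bfs⁺ : IsBFSPlus G ρ (x ∷ τ')) (ρ-ord : IsOrdering ρ)
  (ρ-prefix : ρ ≡ take k (internals G (x ∷ σ')) ++ rest) where

  open Neighbours G
  private
    module σ-BFS = BFSOrdering σ-bfs
    module τ-BFS = BFSOrdering (proj₁ τ-bfs⁺)

  σ τ : List (Fin m)
  σ = x ∷ σ'
  τ = x ∷ τ'

  ι κ : Fin m → ℕ
  ι = position σ
  κ = position τ

  internal? : Decidable (λ v → isInternal G σ v ≡ true)
  internal? = isInternal? G σ

  I S : List (Fin m)
  I = internals G σ
  S = take k I

  private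
    σ-total : ∀ v → v ∈ σ
    σ-total = proj₂ (proj₁ σ-bfs)

    τ-total : ∀ v → v ∈ τ
    τ-total = proj₂ (proj₁ (proj₁ τ-bfs⁺))

  parent-internal : ∀ {c u} → 0 < ι c → firstNbr G σ c ≡ just u → u ∈ I
  parent-internal {c} {u} 0<ιc first = ∈-filter⁺ internal? (σ-total u)
    (has-child⇒internal {G = G} (σ-total c)
      (Equivalence.from ChildOf⇔nonroot×firstNbr (0<ιc , first)))

  earlier-internal⇒∈S : ∀ {u s} → u ∈ I → s ∈ S → ι u < ι s → u ∈ S
  earlier-internal⇒∈S u∈I s∈S u<s =
    position<⇒∈-take s∈S (position-filter-mono internal? u∈I (∈-take⇒∈ s∈S) u<s)

  ρ-earlier⇒σ-earlier : ∀ {y s} → s ∈ S → position ρ y < position ρ s → ι y < ι s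
  ρ-earlier⇒σ-earlier {y} {s} s∈S y<s = position-filter-reflects-< internal?
    (∈-take⇒∈ y∈S) (∈-take⇒∈ s∈S) (subst₂ _<_ (position-take y∈S) (position-take s∈S) y<s-in-S)
    where
    y<s-in-S+rest : position (S ++ rest) y < position (S ++ rest) s
    y<s-in-S+rest = subst (λ l → position l y < position l s) ρ-prefix y<s
    y∈S : y ∈ S
    y∈S = position-++<⇒∈ˡ s∈S y<s-in-S+rest
    y<s-in-S : position S y < position S s
    y<s-in-S = subst₂ _<_ (position-++ˡ y∈S) (position-++ˡ s∈S) y<s-in-S+rest

  τ-Prefix⊆σ-Prefix : Fin m → Set
  τ-Prefix⊆σ-Prefix s = ∀ y → κ y < κ s → ι y < ι s

  σ-parent⇒τ-parent : ∀ {p c} → τ-Prefix⊆σ-Prefix p →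
    firstNbr G σ c ≡ just p → firstNbr G τ c ≡ just p
  σ-parent⇒τ-parent {p} inherited first = leftmost⇒firstNbr (τ-total p) (firstNbr-adj {σ} first)
    λ y _ y∼c → ≮⇒≥ λ y<p → <⇒≱ (inherited y y<p) (firstNbr-leftmost first (σ-total y) y∼c)

  nbr-before-parent⇒earlier : ∀ {s p y q} → 0 < ι s → firstNbr G σ s ≡ just p → y ≢ s →
    adj G q y ≡ true → ι q < ι p → ι y < ι s
  nbr-before-parent⇒earlier {s} {p} {y} {q} 0<ιs first-s y≢s q∼y q<p with <-cmp (ι y) (ι s)
  ... | tri< y<s _ _ = y<s
  ... | tri≈ _ y=s _ = ⊥-elim (y≢s (position-injective (σ-total y) (σ-total s) y=s))
  ... | tri> _ _ s<y with σ-BFS.parent-earlier y (<-trans 0<ιs s<y)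
  ...   | q' , first-y , _ = ⊥-elim (<⇒≱ q<p (begin
    ι p  ≤⟨ σ-BFS.parent-monotone 0<ιs s<y first-s first-y ⟩
    ι q' ≤⟨ firstNbr-leftmost first-y (σ-total q) q∼y ⟩
    ι q  ∎))
    where open ≤-Reasoning

  τ-sibling⇒earlier : ∀ {y s p} → s ∈ S → 0 < κ y → κ y < κ s →
    firstNbr G τ y ≡ just p → firstNbr G τ s ≡ just p → ι y < ι s
  τ-sibling⇒earlier {y} {s} s∈S 0<κy y<s first-y first-s = ρ-earlier⇒σ-earlier s∈S
    (≤∧≢⇒< (Before⇒position≤ (proj₁ ρ-ord)
             (τ-BFS.siblings-in-ρ-order τ-bfs⁺ 0<κy y<s first-y first-s))
           (λ y=s → <-irrefl (cong κ (position-injective (ρ-total y) (ρ-total s) y=s)) y<s))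
    where
    ρ-total : ∀ v → v ∈ ρ
    ρ-total = proj₂ ρ-ord

  τ-Prefix⊆σ-Prefix-from-parent : ∀ {s p} → s ∈ S → τ-Prefix⊆σ-Prefix p → 0 < ι s →
    firstNbr G σ s ≡ just p → τ-Prefix⊆σ-Prefix s
  τ-Prefix⊆σ-Prefix-from-parent {s} {p} s∈S inherited 0<ιs first-s y y<s
    with head⊎0<position {x = x} {xs = τ'} y
  ... | inj₁ refl = subst (_< ι s) (sym position-head) 0<ιs
  ... | inj₂ 0<κy with τ-BFS.parent-earlier y 0<κy
  ...   | q , first-y , _
    with m≤n⇒m<n∨m≡n (τ-BFS.parent-monotone 0<κy y<s first-y (σ-parent⇒τ-parent inherited first-s))
  ...     | inj₁ q<p = nbr-before-parent⇒earlier 0<ιs first-s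
              (λ { refl → <-irrefl refl y<s }) (firstNbr-adj {τ} first-y) (inherited q q<p)
  ...     | inj₂ q=p with refl ← position-injective (τ-total q) (τ-total p) q=p =
              τ-sibling⇒earlier s∈S 0<κy y<s first-y (σ-parent⇒τ-parent inherited first-s)

  ∈S⇒τ-Prefix⊆σ-Prefix : ∀ s → s ∈ S → τ-Prefix⊆σ-Prefix s
  ∈S⇒τ-Prefix⊆σ-Prefix = WF.All.wfRec (On.wellFounded ι <-wellFounded) 0ℓ
    (λ s → s ∈ S → τ-Prefix⊆σ-Prefix s) τ-Prefix⊆σ-Prefix-from-earlier
    where
    τ-Prefix⊆σ-Prefix-from-earlier : ∀ s → (∀ {p} → ι p < ι s → p ∈ S → τ-Prefix⊆σ-Prefix p) →
      s ∈ S → τ-Prefix⊆σ-Prefix s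
    τ-Prefix⊆σ-Prefix-from-earlier s ih s∈S y y<s =
      let 0<ιs = 0<position-∷ {xs = τ'} (≤-<-trans z≤n y<s)
          p , first-s , p<s = σ-BFS.parent-earlier s 0<ιs
          p∈S = earlier-internal⇒∈S (parent-internal 0<ιs first-s) s∈S p<s
      in τ-Prefix⊆σ-Prefix-from-parent s∈S (ih p<s p∈S) 0<ιs first-s y y<s

  τ-parent⇒σ-parent : ∀ {v c} → v ∈ S → 0 < ι c →
    firstNbr G τ c ≡ just v → firstNbr G σ c ≡ just v
  τ-parent⇒σ-parent {v} {c} v∈S 0<ιc first-τ with σ-BFS.parent-earlier c 0<ιc
  ... | u , first-σ , _
    with m≤n⇒m<n∨m≡n (firstNbr-leftmost first-σ (σ-total v) (firstNbr-adj {τ} first-τ))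
  ...   | inj₁ u<v =
    let u∈S = earlier-internal⇒∈S (parent-internal 0<ιc first-σ) v∈S u<v
    in trans first-σ (trans (sym (σ-parent⇒τ-parent (∈S⇒τ-Prefix⊆σ-Prefix u u∈S) first-σ)) first-τ)
  ...   | inj₂ u=v =
    subst (λ w → firstNbr G σ c ≡ just w) (position-injective (σ-total u) (σ-total v) u=v) first-σ

  children-agree : ∀ {v} → v ∈ S → ∀ c → ChildOf G σ v c ⇔ ChildOf G τ v c
  children-agree {v} v∈S c = mk⇔
    (λ σ-child → let 0<ιc , first = to (ChildOf⇔nonroot×firstNbr {σ}) σ-child in
      from (ChildOf⇔nonroot×firstNbr {τ})
        (0<position-∷ 0<ιc , σ-parent⇒τ-parent (∈S⇒τ-Prefix⊆σ-Prefix v v∈S) first))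
    (λ τ-child → let 0<κc , first = to (ChildOf⇔nonroot×firstNbr {τ}) τ-child
                     0<ιc = 0<position-∷ 0<κc in
      from (ChildOf⇔nonroot×firstNbr {σ}) (0<ιc , τ-parent⇒σ-parent v∈S 0<ιc first))
    where open Equivalence

ordering-nonempty : ∀ {n} {σ : List (Fin (suc n))} → IsOrdering σ → ∃₂ λ x σ' → σ ≡ x ∷ σ'
ordering-nonempty {σ = x ∷ σ'} _         = x , σ' , refl
ordering-nonempty {σ = []}     (_ , total) with () ← total zero

root-internal : ∀ {m} {G : Graph m} {x σ'} → isInternal G (x ∷ σ') x ≡ true
root-internal {x = x} with x ≟ x
... | yes _   = refl
... | no  x≢x = ⊥-elim (x≢x refl)

ρ-starts-with-root : ∀ {m} {G : Graph m} {x σ' ρ rest k v} →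
  v ∈ take k (internals G (x ∷ σ')) → ρ ≡ take k (internals G (x ∷ σ')) ++ rest →
  ∃ λ ρ' → ρ ≡ x ∷ ρ'
ρ-starts-with-root {k = zero} ()
ρ-starts-with-root {G = G} {x} {σ'} {rest = rest} {suc k} _ ρ-prefix =
  _ , trans ρ-prefix (cong (λ l → take (suc k) l ++ rest)
                        (filter-accept (isInternal? G (x ∷ σ')) (root-internal {G = G} {x} {σ'})))

BFS⁺-starts-with-ρ-head : ∀ {m} {G : Graph m} {ρ w τ' x ρ'} → IsBFSPlus G ρ (w ∷ τ') →
  Unique ρ → ρ ≡ x ∷ ρ' → x ≡ w
BFS⁺-starts-with-ρ-head {w = w} {τ'} {x} {ρ'} (_ , ρ-least) ρ! refl =
  position≡0⇒head (n≤0⇒n≡0 (subst (position (x ∷ ρ') w ≤_) position-head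
    (Before⇒position≤ ρ! (ρ-least [] w τ' refl x ((λ ()) , inj₁ refl)))))

lemma4p6 : ∀ {n} (G : Graph (suc n)) → Connected G →
    (σ : List (Fin (suc n))) → IsBFS G σ →
    (k : ℕ) → k ≤ length (internals G σ) →
    (ρ : List (Fin (suc n))) → IsOrdering ρ →
    (Σ (List (Fin (suc n))) λ rest → ρ ≡ take k (internals G σ) ++ rest) →
    (τ : List (Fin (suc n))) → IsBFSPlus G ρ τ →
    ∀ v → v ∈ take k (internals G σ) →
    ∀ c → ChildOf G σ v c ⇔ ChildOf G τ v c
lemma4p6 G _ σ σ-bfs k _ ρ ρ-ord (rest , ρ-prefix) τ τ-bfs⁺ v v∈S c
  with x , σ' , refl ← ordering-nonempty (proj₁ σ-bfs)
     | w , τ' , refl ← ordering-nonempty (proj₁ (proj₁ τ-bfs⁺))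
  with _ , ρ-head ← ρ-starts-with-root {G = G} {x = x} v∈S ρ-prefix
  with refl ← BFS⁺-starts-with-ρ-head τ-bfs⁺ (proj₁ ρ-ord) ρ-head
  = BFSPlusOnInternalPrefix.children-agree k σ-bfs τ-bfs⁺ ρ-ord ρ-prefix v∈S c
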